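{- Let $S$ be a homogeneous monoid. Then for all $u,v\in S$, $\tau(uv)\le\tau(u)\tau(v)$, and equality holds if and only if $(u,v)\in\mathfrak C_1$ (i.e. $u,v$ are castled-free).
   Context: Integral monoid: $G$ countable group, $G\ne\{1\}$, $S\subseteq G$ submonoid with (I) $S\cap S^{ -1}=\{1\}$; (II) every $u\in G$ can be written $u=xy^{ -1}$ ($x,y\in S$) such that whenever $u=zw^{ -1}$ with $z,w\in S$ there is $c\in S$ with $z=xc,w=yc$; (III) each $u\in S$ has finitely many factorizations in $S$. Write $u\mid w$ if $w\in uS$. $\mathrm{lcm}[u,v]$ is the unique $w\in S$ with $uS\cap vS=wS$, and $\gcd(u,v)$ is the lcm of all common divisors of $u,v$. Let $\mathfrak C_1=\{(u,u^{ -1}\mathrm{lcm}[u,v]): u,v\in S,\ \gcd(u,v)=1\}$ and $\Gamma_1=\{((u,u^{ -1}\mathrm{lcm}[u,v]),(v,v^{ -1}\mathrm{lcm}[u,v])): u,v\in S,\ \gcd(u,v)=1\}\subseteq\mathfrak C_1\times\mathfrak C_1$. $S$ is homogeneous if it is an integral monoid and (Axiom IV') $\Gamma_1$ is the graph of a map $\mathfrak C_1\to\mathfrak C_1$. The divisor function is $\tau(z)=\#\{(z_1,z_2)\in S\times S: z=z_1z_2\}$. -}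

module Defs where

open import Level using (0ℓ)
open import Data.Nat using (ℕ)
open import Data.Product using (Σ; ∃; ∃-syntax; _×_; _,_)
open import Data.List using (List; length)
open import Data.List.Membership.Propositional using (_∈_)
open import Data.List.Relation.Unary.Unique.Propositional using (Unique)
open import Relation.Binary.PropositionalEquality using (_≡_)
open import Relation.Nullary using (¬_)
open import Function.Bundles using (_⇔_)
open import Function.Definitions using (Injective)
open import Algebra.Structures using (IsGroup)

HasCard : {X : Set} → (X → Set) → ℕ → Set
HasCard {X} P n = Σ (List X) λ xs → Unique xs × (∀ x → (x ∈ xs) ⇔ P x) × length xs ≡ n

IsFinite : {X : Set} → (X → Set) → Set
IsFinite P = ∃[ n ] HasCard P n

module Monoid {A : Set} (_∙_ : A → A → A) (ε : A) (_⁻¹ : A → A) (S : A → Set) where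

  _∣_ : A → A → Set
  u ∣ w = ∃[ c ] (S c × w ≡ u ∙ c)

  Fact : A → A × A → Set
  Fact z (z₁ , z₂) = S z₁ × S z₂ × z ≡ z₁ ∙ z₂

  TauIs : A → ℕ → Set
  TauIs z n = HasCard (Fact z) n

  IsLcm : A → A → A → Set
  IsLcm u v w = S w × (∀ t → ((u ∣ t) × (v ∣ t)) ⇔ (w ∣ t))

  -- d = gcd(u,v) : d is the lcm of all common divisors of u and v,
  -- i.e. d ∈ S and dS = ⋂ { eS : e ∣ u , e ∣ v }
  IsGcd : A → A → A → Set
  IsGcd u v d = S d × (∀ t → (∀ e → e ∣ u → e ∣ v → e ∣ t) ⇔ (d ∣ t))

  C₁ : A × A → Set
  C₁ (a , b) = ∃[ u ] ∃[ v ] ∃[ l ]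
    (S u × S v × IsGcd u v ε × IsLcm u v l × a ≡ u × b ≡ (u ⁻¹) ∙ l)

  Γ₁ : A × A → A × A → Set
  Γ₁ (a , b) (c , d) = ∃[ u ] ∃[ v ] ∃[ l ]
    (S u × S v × IsGcd u v ε × IsLcm u v l
      × a ≡ u × b ≡ (u ⁻¹) ∙ l × c ≡ v × d ≡ (v ⁻¹) ∙ l)

  record IsHomogeneous : Set where
    field
      isGroup     : IsGroup _≡_ _∙_ ε _⁻¹
      countable   : Σ (A → ℕ) λ f → Injective _≡_ _≡_ f
      nontrivial  : ∃[ g ] ¬ (g ≡ ε)
      S-ε         : S ε
      S-∙         : ∀ {x y} → S x → S y → S (x ∙ y)
      axI         : ∀ x → S x → S (x ⁻¹) → x ≡ ε
      axII        : ∀ u → ∃[ x ] ∃[ y ] (S x × S y × u ≡ x ∙ (y ⁻¹)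
                      × (∀ z w → S z → S w → u ≡ z ∙ (w ⁻¹)
                           → ∃[ c ] (S c × z ≡ x ∙ c × w ≡ y ∙ c)))
      axIII       : ∀ u → S u → IsFinite (Fact u)
      -- (IV') Γ₁ is the graph of a map 𝔠₁ → 𝔠₁ (Γ₁ ⊆ 𝔠₁ × 𝔠₁ holds by definition)
      axIV'-map   : ∀ p → C₁ p → ∃[ q ] (Γ₁ p q × (∀ q' → Γ₁ p q' → q' ≡ q))

open Monoid public

{-# OPTIONS --safe #-}

-- A factorization uv = z₁z₂ determines d = gcd(u, z₁), the splitting u = d u₁ and, writing
-- lcm[u₁, d⁻¹z₁] = u₁b, a splitting v = b v₁ (b divides v because d⁻¹z₁ divides u₁v).
-- Axiom (IV′) says that w and lcm[x, w] determine x when x is coprime to w; as d⁻¹z₁ is coprime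
-- to u₁, the pair of splittings determines z₁ and hence z. This injection of the factorizations
-- of uv into pairs of factorizations of u and v gives τ(uv) ≤ τ(u)τ(v). Equality makes the
-- injection onto, and a preimage of ((1, u), (v, 1)) is a z₁ coprime to u with lcm[u, z₁] = uv,
-- i.e. (u, v) ∈ 𝔠₁. Conversely 𝔠₁ is closed under (d u₁, b v₁) ↦ (u₁, b), and a witness w for
-- (u₁, b) ∈ 𝔠₁ gives the preimage z₁ = d w of ((d, u₁), (b, v₁)).

module Submission where

open import Level using (0ℓ)
open import Data.Nat using (suc; _≤_; _*_; _+_; z≤n; s≤s)
open import Data.Nat.Properties using (≤-pred; ≤-antisym; ≤-reflexive; eq?; module ≤-Reasoning)
open import Data.Product using (∃; ∃-syntax; _×_; _,_; proj₁; proj₂)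
open import Data.Product.Properties using (≡-dec)
open import Data.List using (List; []; _∷_; length; map; filter; cartesianProduct; _++_)
open import Data.List.Properties using (length-++; length-map; length-removeAt′)
open import Data.List.Membership.Propositional using (_∈_)
open import Data.List.Membership.Propositional.Properties
  using (∈-map⁺; ∈-map⁻; ∈-filter⁺; ∈-filter⁻; ∈-cartesianProduct⁺; ∈-cartesianProduct⁻)
open import Data.List.Relation.Unary.Any using (here; there; index; _─_)
open import Data.List.Relation.Unary.All as All using (All; []; _∷_)
open import Data.List.Relation.Unary.AllPairs using (_∷_)
open import Data.List.Relation.Unary.Unique.Propositional using (Unique)
open import Data.List.Relation.Unary.Unique.Propositional.Properties using (cartesianProduct⁺)
open import Data.Empty using (⊥-elim)
open import Function using (_∘_)
open import Function.Bundles using (_⇔_; mk⇔; mk↣; Equivalence)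
open import Relation.Binary.Definitions using (DecidableEquality)
open import Relation.Binary.PropositionalEquality
  using (_≡_; _≢_; refl; sym; trans; cong; cong₂; subst; subst₂; module ≡-Reasoning)
open import Relation.Nullary using (yes; no)
open import Algebra.Bundles using (Group)
open import Algebra.Structures using (IsGroup)
import Algebra.Properties.Group as GroupProperties
import Data.List.Membership.DecPropositional as DecMembership
import Defs

-- Counting along a relation between lists

length-cartesianProduct : ∀ {X Y : Set} (xs : List X) (ys : List Y) →
  length (cartesianProduct xs ys) ≡ length xs * length ys
length-cartesianProduct []       ys = refl
length-cartesianProduct (x ∷ xs) ys = begin
  length (map (x ,_) ys ++ cartesianProduct xs ys)          ≡⟨ length-++ (map (x ,_) ys) ⟩
  length (map (x ,_) ys) + length (cartesianProduct xs ys)  ≡⟨ cong₂ _+_ (length-map (x ,_) ys)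
                                                                          (length-cartesianProduct xs ys) ⟩
  length ys + length xs * length ys                         ∎
  where open ≡-Reasoning

∈-─⁺ : ∀ {X : Set} {x y : X} {xs} (x∈xs : x ∈ xs) → y ∈ xs → x ≢ y → y ∈ (xs ─ x∈xs)
∈-─⁺ (here refl)  (here refl)  x≢y = ⊥-elim (x≢y refl)
∈-─⁺ (here refl)  (there y∈xs) _   = y∈xs
∈-─⁺ (there _)    (here refl)  _   = here refl
∈-─⁺ (there x∈xs) (there y∈xs) x≢y = there (∈-─⁺ x∈xs y∈xs x≢y)

module _ {X Y : Set} (R : X → Y → Set) where

  TotalOn : List X → List Y → Set
  TotalOn xs ys = ∀ {x} → x ∈ xs → ∃[ y ] (y ∈ ys × R x y)

  InjectiveOn : List X → Set
  InjectiveOn xs = ∀ {x x′ y} → x ∈ xs → x′ ∈ xs → R x y → R x′ y → x ≡ x′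

  private
    injectiveOn-∷⁻ : ∀ {x xs} → InjectiveOn (x ∷ xs) → InjectiveOn xs
    injectiveOn-∷⁻ inj x∈xs x′∈xs = inj (there x∈xs) (there x′∈xs)

    totalOn-─ : ∀ {x xs ys y} → All (x ≢_) xs → InjectiveOn (x ∷ xs) → TotalOn (x ∷ xs) ys →
                (y∈ys : y ∈ ys) → R x y → TotalOn xs (ys ─ y∈ys)
    totalOn-─ {y = y} x∉xs inj tot y∈ys rxy {x′} x′∈xs with tot (there x′∈xs)
    ... | y′ , y′∈ys , rx′y′ = y′ , ∈-─⁺ y∈ys y′∈ys y≢y′ , rx′y′
      where
      y≢y′ : y ≢ y′
      y≢y′ refl = All.lookup x∉xs x′∈xs (inj (here refl) (there x′∈xs) rxy rx′y′)

  injectiveOn⇒length≤ : ∀ {xs ys} → Unique xs → TotalOn xs ys → InjectiveOn xs →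
                        length xs ≤ length ys
  injectiveOn⇒length≤ {[]} _ _ _ = z≤n
  injectiveOn⇒length≤ {x ∷ xs} {ys} (x∉xs ∷ xs!) tot inj with tot (here refl)
  ... | y , y∈ys , rxy = begin
    suc (length xs)           ≤⟨ s≤s (injectiveOn⇒length≤ xs! (totalOn-─ x∉xs inj tot y∈ys rxy)
                                                             (injectiveOn-∷⁻ inj)) ⟩
    suc (length (ys ─ y∈ys))  ≡⟨ length-removeAt′ ys (index y∈ys) ⟨
    length ys                 ∎
    where open ≤-Reasoning

  injectiveOn∧length≥⇒surjective : DecidableEquality Y → ∀ {xs ys} → Unique xs →
    TotalOn xs ys → InjectiveOn xs → length ys ≤ length xs →
    ∀ {y₀} → y₀ ∈ ys → ∃[ x ] (x ∈ xs × R x y₀)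
  injectiveOn∧length≥⇒surjective _≟_ {[]} {_ ∷ _} _ _ _ () _
  injectiveOn∧length≥⇒surjective _≟_ {x ∷ xs} {ys} (x∉xs ∷ xs!) tot inj ys≤ {y₀} y₀∈ys
    with tot (here refl)
  ... | y , y∈ys , rxy with y ≟ y₀
  ...   | yes refl = x , here refl , rxy
  ...   | no y≢y₀
    with injectiveOn∧length≥⇒surjective _≟_ xs! (totalOn-─ x∉xs inj tot y∈ys rxy)
           (injectiveOn-∷⁻ inj) (≤-pred (subst (_≤ suc (length xs)) (length-removeAt′ ys (index y∈ys)) ys≤))
           (∈-─⁺ y∈ys y₀∈ys y≢y₀)
  ...     | x′ , x′∈xs , rx′y₀ = x′ , there x′∈xs , rx′y₀

module Homogeneous {A : Set} (_∙_ : A → A → A) (ε : A) (_⁻¹ : A → A) (S : A → Set)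
                   (homogeneous : Defs.IsHomogeneous _∙_ ε _⁻¹ S) where

  open Defs.Monoid _∙_ ε _⁻¹ S
  open IsHomogeneous homogeneous
  open IsGroup isGroup using (assoc; identityˡ; identityʳ; _\\_)

  group : Group 0ℓ 0ℓ
  group = record { Carrier = A ; _≈_ = _≡_ ; _∙_ = _∙_ ; ε = ε ; _⁻¹ = _⁻¹ ; isGroup = isGroup }

  open GroupProperties group
    using (∙-cancelˡ; \\-leftDividesˡ; \\-leftDividesʳ; //-rightDividesˡ; x≈z//y; inverseʳ-unique)
  open Equivalence using (to; from)

  _≟_ : DecidableEquality A
  _≟_ = eq? (mk↣ (proj₂ countable))

  ∣-refl : ∀ {u} → u ∣ u
  ∣-refl = ε , S-ε , sym (identityʳ _)

  ∣-trans : ∀ {u v w} → u ∣ v → v ∣ w → u ∣ w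
  ∣-trans (c , Sc , refl) (c′ , Sc′ , refl) = c ∙ c′ , S-∙ Sc Sc′ , assoc _ c c′

  u∣u∙c : ∀ {u c} → S c → u ∣ (u ∙ c)
  u∣u∙c Sc = _ , Sc , refl

  ε∣ : ∀ {t} → S t → ε ∣ t
  ε∣ St = _ , St , sym (identityˡ _)

  ∣-resp-S : ∀ {u w} → S u → u ∣ w → S w
  ∣-resp-S Su (c , Sc , refl) = S-∙ Su Sc

  ∣⇒\\-S : ∀ {d z} → d ∣ z → S (d \\ z)
  ∣⇒\\-S {d} (c , Sc , refl) = subst S (sym (\\-leftDividesʳ d c)) Sc

  ∙-monoʳ-∣ : ∀ d {u w} → u ∣ w → (d ∙ u) ∣ (d ∙ w)
  ∙-monoʳ-∣ d (c , Sc , refl) = c , Sc , sym (assoc d _ c)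

  ∙-cancelˡ-∣ : ∀ d {u w} → (d ∙ u) ∣ (d ∙ w) → u ∣ w
  ∙-cancelˡ-∣ d (c , Sc , eq) = c , Sc , ∙-cancelˡ d _ _ (trans eq (assoc d _ c))

  ∣∙⇒\\∣ : ∀ {e d a} → e ∣ (d ∙ a) → (d \\ e) ∣ a
  ∣∙⇒\\∣ {e} {d} e∣da = ∙-cancelˡ-∣ d (subst (_∣ _) (sym (\\-leftDividesˡ d e)) e∣da)

  \\∣⇒∣∙ : ∀ {e d a} → (d \\ e) ∣ a → e ∣ (d ∙ a)
  \\∣⇒∣∙ {e} {d} d\\e∣a = subst (_∣ _) (\\-leftDividesˡ d e) (∙-monoʳ-∣ d d\\e∣a)

  ∙∣⇒∣\\ : ∀ {g a l} → (g ∙ a) ∣ l → a ∣ (g \\ l)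
  ∙∣⇒∣\\ {g} {a} {l} ga∣l = ∙-cancelˡ-∣ g (subst ((g ∙ a) ∣_) (sym (\\-leftDividesˡ g l)) ga∣l)

  ∣-antisym : ∀ {u w} → u ∣ w → w ∣ u → u ≡ w
  ∣-antisym {u} (c , Sc , refl) (c′ , Sc′ , u≡ucc′) = begin
    u      ≡⟨ identityʳ u ⟨
    u ∙ ε  ≡⟨ cong (u ∙_) c≡ε ⟨
    u ∙ c  ∎
    where
    open ≡-Reasoning
    cc′≡ε : c ∙ c′ ≡ ε
    cc′≡ε = ∙-cancelˡ u _ _ (trans (sym (assoc u c c′)) (trans (sym u≡ucc′) (sym (identityʳ u))))
    c≡ε : c ≡ ε
    c≡ε = axI c Sc (subst S (inverseʳ-unique c c′ cc′≡ε) Sc′)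

  -- Least common multiples and greatest common divisors

  isLcm : ∀ {u v l} → S l → u ∣ l → v ∣ l → (∀ {t} → u ∣ t → v ∣ t → l ∣ t) → IsLcm u v l
  isLcm Sl u∣l v∣l least = Sl , λ _ → mk⇔ (λ (u∣t , v∣t) → least u∣t v∣t)
                                           (λ l∣t → ∣-trans u∣l l∣t , ∣-trans v∣l l∣t)

  lcm-∣ˡ : ∀ {u v l} → IsLcm u v l → u ∣ l
  lcm-∣ˡ (_ , spec) = proj₁ (from (spec _) ∣-refl)

  lcm-∣ʳ : ∀ {u v l} → IsLcm u v l → v ∣ l
  lcm-∣ʳ (_ , spec) = proj₂ (from (spec _) ∣-refl)

  lcm-least : ∀ {u v l t} → IsLcm u v l → u ∣ t → v ∣ t → l ∣ t
  lcm-least (_ , spec) u∣t v∣t = to (spec _) (u∣t , v∣t)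

  IsLcm-sym : ∀ {u v l} → IsLcm u v l → IsLcm v u l
  IsLcm-sym L = isLcm (proj₁ L) (lcm-∣ʳ L) (lcm-∣ˡ L) (λ v∣t u∣t → lcm-least L u∣t v∣t)

  lcm-unique : ∀ {u v l l′} → IsLcm u v l → IsLcm u v l′ → l ≡ l′
  lcm-unique L L′ =
    ∣-antisym (lcm-least L (lcm-∣ˡ L′) (lcm-∣ʳ L′)) (lcm-least L′ (lcm-∣ˡ L) (lcm-∣ʳ L))

  -- Axiom (II) applied to u⁻¹v = x y⁻¹ : the reduced fraction gives lcm[u,v] = ux = vy.
  lcm-exists : ∀ {u v} → S u → ∃[ c ] (S c × IsLcm u v (u ∙ c))
  lcm-exists {u} {v} Su with axII (u \\ v)
  ... | x , y , Sx , Sy , u\\v≡x/y , reduced = x , Sx , isLcm (S-∙ Su Sx) (u∣u∙c Sx) (y , Sy , sym vy≡ux) least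
    where
    open ≡-Reasoning
    vy≡ux : v ∙ y ≡ u ∙ x
    vy≡ux = begin
      v ∙ y                          ≡⟨ cong (_∙ y) (\\-leftDividesˡ u v) ⟨
      (u ∙ (u \\ v)) ∙ y             ≡⟨ cong (λ w → (u ∙ w) ∙ y) u\\v≡x/y ⟩
      (u ∙ (x ∙ (y ⁻¹))) ∙ y         ≡⟨ assoc u _ y ⟩
      u ∙ ((x ∙ (y ⁻¹)) ∙ y)         ≡⟨ cong (u ∙_) (//-rightDividesˡ y x) ⟩
      u ∙ x                          ∎
    least : ∀ {t} → u ∣ t → v ∣ t → (u ∙ x) ∣ t
    least (p , Sp , refl) (q , Sq , up≡vq) with reduced p q Sp Sq (x≈z//y (u \\ v) q p u\\v∙q≡p)
      where
      u\\v∙q≡p : (u \\ v) ∙ q ≡ p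
      u\\v∙q≡p = trans (assoc (u ⁻¹) v q) (trans (cong (u \\_) (sym up≡vq)) (\\-leftDividesʳ u p))
    ... | c , Sc , p≡xc , _ = c , Sc , trans (cong (u ∙_) p≡xc) (sym (assoc u x c))

  lcmAll-exists : ∀ {es} → All S es →
    ∃[ l ] (S l × All (_∣ l) es × (∀ {t} → ε ∣ t → All (_∣ t) es → l ∣ t))
  lcmAll-exists [] = ε , S-ε , [] , λ ε∣t _ → ε∣t
  lcmAll-exists {e ∷ _} (Se ∷ Ses) with lcmAll-exists Ses
  ... | l , _ , es∣l , l-least with lcm-exists {v = l} Se
  ...   | c , _ , L = e ∙ c , proj₁ L , lcm-∣ˡ L ∷ All.map (λ e′∣l → ∣-trans e′∣l (lcm-∣ʳ L)) es∣l
                    , λ { ε∣t (e∣t ∷ es∣t) → lcm-least L e∣t (l-least ε∣t es∣t) }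

  isGcd : ∀ {x y d} → S d → d ∣ x → d ∣ y → (∀ {e} → e ∣ x → e ∣ y → e ∣ d) → IsGcd x y d
  isGcd Sd d∣x d∣y greatest = Sd , λ _ → mk⇔ (λ common∣t → common∣t _ d∣x d∣y)
                                               (λ d∣t e e∣x e∣y → ∣-trans (greatest e∣x e∣y) d∣t)

  gcd-∣ˡ : ∀ {x y d} → IsGcd x y d → d ∣ x
  gcd-∣ˡ (_ , spec) = to (spec _) (λ _ e∣x _ → e∣x)

  gcd-∣ʳ : ∀ {x y d} → IsGcd x y d → d ∣ y
  gcd-∣ʳ (_ , spec) = to (spec _) (λ _ _ e∣y → e∣y)

  gcd-greatest : ∀ {x y d e} → IsGcd x y d → e ∣ x → e ∣ y → e ∣ d
  gcd-greatest (_ , spec) e∣x e∣y = from (spec _) ∣-refl _ e∣x e∣y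

  gcd-unique : ∀ {x y d d′} → IsGcd x y d → IsGcd x y d′ → d ≡ d′
  gcd-unique G G′ =
    ∣-antisym (gcd-greatest G′ (gcd-∣ˡ G) (gcd-∣ʳ G)) (gcd-greatest G (gcd-∣ˡ G′) (gcd-∣ʳ G′))

  IsGcd-∣ : ∀ {x x′ y d} → IsGcd x y d → d ∣ x′ → x′ ∣ x → IsGcd x′ y d
  IsGcd-∣ G d∣x′ x′∣x =
    isGcd (proj₁ G) d∣x′ (gcd-∣ʳ G) (λ e∣x′ → gcd-greatest G (∣-trans e∣x′ x′∣x))

  IsLcm-∣ : ∀ {x x′ y l} → IsLcm x y l → x ∣ x′ → x′ ∣ l → IsLcm x′ y l
  IsLcm-∣ L x∣x′ x′∣l =
    isLcm (proj₁ L) x′∣l (lcm-∣ʳ L) (λ x′∣t → lcm-least L (∣-trans x∣x′ x′∣t))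

  Coprime : A → A → Set
  Coprime x y = ∀ {e} → e ∣ x → e ∣ y → e ∣ ε

  Coprime-sym : ∀ {x y} → Coprime x y → Coprime y x
  Coprime-sym x⊥y e∣y e∣x = x⊥y e∣x e∣y

  Coprime-∣ˡ : ∀ {x x′ y} → x′ ∣ x → Coprime x y → Coprime x′ y
  Coprime-∣ˡ x′∣x x⊥y e∣x′ = x⊥y (∣-trans e∣x′ x′∣x)

  IsGcd-ε⇒Coprime : ∀ {x y} → IsGcd x y ε → Coprime x y
  IsGcd-ε⇒Coprime G = gcd-greatest G

  Coprime⇒IsGcd-ε : ∀ {x y} → S x → S y → Coprime x y → IsGcd x y ε
  Coprime⇒IsGcd-ε Sx Sy = isGcd S-ε (ε∣ Sx) (ε∣ Sy)

  gcd-cofactors-coprime : ∀ {x y d a c} → IsGcd x y d → x ≡ d ∙ a → y ≡ d ∙ c → Coprime a c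
  gcd-cofactors-coprime {d = d} G x≡da y≡dc {e} e∣a e∣c =
    ∙-cancelˡ-∣ d (subst ((d ∙ e) ∣_) (sym (identityʳ d))
      (gcd-greatest G (subst ((d ∙ e) ∣_) (sym x≡da) (∙-monoʳ-∣ d e∣a))
                      (subst ((d ∙ e) ∣_) (sym y≡dc) (∙-monoʳ-∣ d e∣c))))

  Coprime⇒IsGcd-∙ : ∀ {d a c} → S d → S a → S c → Coprime a c → IsGcd (d ∙ a) (d ∙ c) d
  Coprime⇒IsGcd-∙ {d} Sd Sa Sc a⊥c = isGcd Sd (u∣u∙c Sa) (u∣u∙c Sc)
    (λ {e} e∣da e∣dc →
      subst (e ∣_) (identityʳ d) (\\∣⇒∣∙ (a⊥c (∣∙⇒\\∣ e∣da) (∣∙⇒\\∣ e∣dc))))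

  numerator : A → A
  numerator e = proj₁ (axII e)

  numerator-S : ∀ e → S (numerator e)
  numerator-S e = proj₁ (proj₂ (proj₂ (axII e)))

  ∣numerator : ∀ e → e ∣ numerator e
  ∣numerator e with axII e
  ... | x , y , _ , Sy , e≡x/y , _ = y , Sy , sym (trans (cong (_∙ y) e≡x/y) (//-rightDividesˡ y x))

  -- IsGcd quantifies over divisors in all of G; this reduces them to divisors lying in S.
  numerator-least : ∀ {e w} → S w → e ∣ w → numerator e ∣ w
  numerator-least {e} {w} Sw (c , Sc , w≡ec) with axII e
  ... | _ , _ , _ , _ , _ , reduced with reduced w c Sw Sc (x≈z//y e c w (sym w≡ec))
  ...   | k , Sk , w≡xk , _ = k , Sk , w≡xk

  factors : ∀ {w} → S w → List (A × A)
  factors {w} Sw = proj₁ (proj₂ (axIII w Sw))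

  ∈-factors : ∀ {w} (Sw : S w) p → (p ∈ factors Sw) ⇔ Fact w p
  ∈-factors {w} Sw = proj₁ (proj₂ (proj₂ (proj₂ (axIII w Sw))))

  leftDivisors : ∀ {w} → S w → List A
  leftDivisors Sw = map proj₁ (factors Sw)

  ∈-leftDivisors⁺ : ∀ {w e} (Sw : S w) → S e → e ∣ w → e ∈ leftDivisors Sw
  ∈-leftDivisors⁺ Sw Se (c , Sc , w≡ec) = ∈-map⁺ proj₁ (from (∈-factors Sw _) (Se , Sc , w≡ec))

  ∈-leftDivisors⁻ : ∀ {w e} (Sw : S w) → e ∈ leftDivisors Sw → S e × e ∣ w
  ∈-leftDivisors⁻ Sw e∈ with ∈-map⁻ proj₁ e∈
  ... | (_ , c) , p∈ , refl with to (∈-factors Sw _) p∈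
  ...   | Se , Sc , w≡ec = Se , c , Sc , w≡ec

  module _ {u z : A} (Su : S u) (Sz : S z) where

    open DecMembership _≟_ using (_∈?_)

    private
      commonDivisors : List A
      commonDivisors = filter (_∈? leftDivisors Sz) (leftDivisors Su)

      ∈-commonDivisors⁺ : ∀ {e} → S e → e ∣ u → e ∣ z → e ∈ commonDivisors
      ∈-commonDivisors⁺ Se e∣u e∣z =
        ∈-filter⁺ (_∈? leftDivisors Sz) (∈-leftDivisors⁺ Su Se e∣u) (∈-leftDivisors⁺ Sz Se e∣z)

      ∈-commonDivisors⁻ : ∀ {e} → e ∈ commonDivisors → S e × e ∣ u × e ∣ z
      ∈-commonDivisors⁻ e∈ with ∈-filter⁻ (_∈? leftDivisors Sz) e∈
      ... | e∈u , e∈z = proj₁ (∈-leftDivisors⁻ Su e∈u) , proj₂ (∈-leftDivisors⁻ Su e∈u)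
                      , proj₂ (∈-leftDivisors⁻ Sz e∈z)

    gcd-exists : ∃ (IsGcd u z)
    gcd-exists with lcmAll-exists (All.tabulate (λ e∈ → proj₁ (∈-commonDivisors⁻ e∈)))
    ... | d , Sd , common∣d , d-least = d , isGcd Sd
      (d-least (ε∣ Su) (All.tabulate (λ e∈ → proj₁ (proj₂ (∈-commonDivisors⁻ e∈)))))
      (d-least (ε∣ Sz) (All.tabulate (λ e∈ → proj₂ (proj₂ (∈-commonDivisors⁻ e∈)))))
      (λ {e} e∣u e∣z → ∣-trans (∣numerator e) (All.lookup common∣d
        (∈-commonDivisors⁺ (numerator-S e) (numerator-least Su e∣u) (numerator-least Sz e∣z))))

  IsLcm-cancelˡ : ∀ {g a c l} → S a → IsLcm (g ∙ a) (g ∙ c) l → IsLcm a c (g \\ l)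
  IsLcm-cancelˡ {g} Sa L = isLcm (∣-resp-S Sa a∣g\\l) a∣g\\l (∙∣⇒∣\\ (lcm-∣ʳ L))
    (λ a∣t c∣t → ∣∙⇒\\∣ (lcm-least L (∙-monoʳ-∣ g a∣t) (∙-monoʳ-∣ g c∣t)))
    where
    a∣g\\l = ∙∣⇒∣\\ (lcm-∣ˡ L)

  IsLcm-∙⁻ : ∀ {d u₁ w w₁ m} → S u₁ → IsLcm d w (d ∙ w₁) → IsLcm (d ∙ u₁) w (d ∙ m) →
    IsLcm u₁ w₁ m
  IsLcm-∙⁻ {d} Su₁ M L = isLcm (∣-resp-S Su₁ u₁∣m) u₁∣m
    (∙-cancelˡ-∣ d (lcm-least M (∣-trans (u∣u∙c Su₁) (lcm-∣ˡ L)) (lcm-∣ʳ L)))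
    (λ u₁∣t w₁∣t → ∙-cancelˡ-∣ d
      (lcm-least L (∙-monoʳ-∣ d u₁∣t) (∣-trans (lcm-∣ʳ M) (∙-monoʳ-∣ d w₁∣t))))
    where
    u₁∣m = ∙-cancelˡ-∣ d (lcm-∣ˡ L)

  coprime⇒Γ₁ : ∀ {y w l} → S y → S w → Coprime y w → IsLcm y w l → Γ₁ (w , w \\ l) (y , y \\ l)
  coprime⇒Γ₁ Sy Sw y⊥w L =
    _ , _ , _ , Sw , Sy , Coprime⇒IsGcd-ε Sw Sy (Coprime-sym y⊥w) , IsLcm-sym L , refl , refl , refl , refl

  Γ₁⇒C₁ : ∀ {p q} → Γ₁ p q → C₁ p
  Γ₁⇒C₁ (u , v , l , Su , Sv , G , L , a≡u , b≡u\\l , _) = u , v , l , Su , Sv , G , L , a≡u , b≡u\\l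

  coprime-complement-unique : ∀ {x x′ w l} → S x → S x′ → S w → Coprime x w → Coprime x′ w →
    IsLcm x w l → IsLcm x′ w l → x ≡ x′
  coprime-complement-unique Sx Sx′ Sw x⊥w x′⊥w L L′ =
    cong proj₁ (trans (partner-unique _ γ) (sym (partner-unique _ γ′)))
    where
    γ  = coprime⇒Γ₁ Sx Sw x⊥w L
    γ′ = coprime⇒Γ₁ Sx′ Sw x′⊥w L′
    partner-unique = proj₂ (proj₂ (axIV'-map _ (Γ₁⇒C₁ γ)))

  complement-unique : ∀ {x x′ w g l} → IsGcd x w g → IsGcd x′ w g → IsLcm x w l → IsLcm x′ w l → x ≡ x′
  complement-unique {g = g} G G′ L L′ with gcd-∣ˡ G | gcd-∣ˡ G′ | gcd-∣ʳ G
  ... | p , Sp , refl | p′ , Sp′ , refl | q , Sq , refl = cong (g ∙_)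
    (coprime-complement-unique Sp Sp′ Sq (gcd-cofactors-coprime G refl refl) (gcd-cofactors-coprime G′ refl refl)
      (IsLcm-cancelˡ Sp L) (IsLcm-cancelˡ Sp′ L′))

  -- With g = gcd(u₁, w₁) one has lcm[d g, w] = lcm[d, w], so d g = d by (IV′).
  Coprime-∙⁻ : ∀ {d u₁ w w₁} → S d → S u₁ → S w → S w₁ → Coprime (d ∙ u₁) w → IsLcm d w (d ∙ w₁) →
    Coprime u₁ w₁
  Coprime-∙⁻ {d} {u₁} {w₁ = w₁} Sd Su₁ Sw Sw₁ du₁⊥w M with gcd-exists Su₁ Sw₁
  ... | g , G = u₁⊥w₁
    where
    Sg = proj₁ G
    d≡dg : d ≡ d ∙ g
    d≡dg = coprime-complement-unique Sd (S-∙ Sd Sg) Sw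
      (Coprime-∣ˡ (u∣u∙c Su₁) du₁⊥w) (Coprime-∣ˡ (∙-monoʳ-∣ d (gcd-∣ˡ G)) du₁⊥w)
      M (IsLcm-∣ M (u∣u∙c Sg) (∙-monoʳ-∣ d (gcd-∣ʳ G)))
    g≡ε : g ≡ ε
    g≡ε = ∙-cancelˡ d g ε (trans (sym d≡dg) (sym (identityʳ d)))
    u₁⊥w₁ : Coprime u₁ w₁
    u₁⊥w₁ {e} e∣u₁ e∣w₁ = subst (e ∣_) g≡ε (gcd-greatest G e∣u₁ e∣w₁)

  CastleFree : A → A → Set
  CastleFree a b = ∃[ w ] (S a × S w × Coprime a w × IsLcm a w (a ∙ b))

  C₁⇒CastleFree : ∀ {a b} → C₁ (a , b) → CastleFree a b
  C₁⇒CastleFree (u , v , l , Su , Sv , G , L , refl , refl) =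
    v , Su , Sv , IsGcd-ε⇒Coprime G , subst (IsLcm u v) (sym (\\-leftDividesˡ u l)) L

  CastleFree⇒C₁ : ∀ {a b} → CastleFree a b → C₁ (a , b)
  CastleFree⇒C₁ {a} {b} (w , Sa , Sw , a⊥w , L) =
    a , w , a ∙ b , Sa , Sw , Coprime⇒IsGcd-ε Sa Sw a⊥w , L , refl , sym (\\-leftDividesʳ a b)

  castleFree-∙ˡ⁻ : ∀ {d u₁ v} → S d → S u₁ → CastleFree (d ∙ u₁) v → CastleFree u₁ v
  castleFree-∙ˡ⁻ {d} {u₁} {v} Sd Su₁ (w , _ , Sw , du₁⊥w , L) with lcm-exists {v = w} Sd
  ... | w₁ , Sw₁ , M = w₁ , Su₁ , Sw₁ , Coprime-∙⁻ Sd Su₁ Sw Sw₁ du₁⊥w M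
                     , IsLcm-∙⁻ Su₁ M (subst (IsLcm (d ∙ u₁) w) (assoc d u₁ v) L)

  -- With g = gcd(x b, w) one has g ∣ lcm[x, g] ∣ x b, so lcm[x, g] and x b have the same
  -- gcd and the same lcm with w, hence coincide.
  castleFree-∙ʳ⁻ : ∀ {x b v₁} → S b → S v₁ → CastleFree x (b ∙ v₁) → CastleFree x b
  castleFree-∙ʳ⁻ {x} {b} Sb Sv₁ (w , Sx , Sw , x⊥w , L) with gcd-exists (S-∙ Sx Sb) Sw
  ... | g , G with lcm-exists {v = g} Sx
  ...   | b₁ , Sb₁ , N = g , Sx , proj₁ G , x⊥g , subst (IsLcm x g) (complement-unique G₁ G L₁ L₂) N
    where
    x⊥g : Coprime x g
    x⊥g = Coprime-sym (Coprime-∣ˡ (gcd-∣ʳ G) (Coprime-sym x⊥w))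
    G₁ : IsGcd (x ∙ b₁) w g
    G₁ = IsGcd-∣ G (lcm-∣ʳ N) (lcm-least N (u∣u∙c Sb) (gcd-∣ˡ G))
    L₁ : IsLcm (x ∙ b₁) w _
    L₁ = IsLcm-∣ L (u∣u∙c Sb₁) (lcm-least N (lcm-∣ˡ L) (∣-trans (gcd-∣ʳ G) (lcm-∣ʳ L)))
    L₂ : IsLcm (x ∙ b) w _
    L₂ = IsLcm-∣ L (u∣u∙c Sb) (∙-monoʳ-∣ x (u∣u∙c Sv₁))

  castleFree-∙⁻ : ∀ {d u₁ b v₁} → S d → S u₁ → S b → S v₁ →
    CastleFree (d ∙ u₁) (b ∙ v₁) → CastleFree u₁ b
  castleFree-∙⁻ Sd Su₁ Sb Sv₁ = castleFree-∙ʳ⁻ Sb Sv₁ ∘ castleFree-∙ˡ⁻ Sd Su₁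

  -- Factorizations of uv

  module Correspondence {u v : A} (Su : S u) (Sv : S v) where

    Splits : A × A → (A × A) × (A × A) → Set
    Splits z@(z₁ , _) ((d , u₁) , (b , v₁)) =
      Fact (u ∙ v) z × Fact u (d , u₁) × Fact v (b , v₁) × IsGcd u z₁ d × IsLcm u₁ (d \\ z₁) (u₁ ∙ b)

    Splits⁻¹ : (A × A) × (A × A) → A × A → Set
    Splits⁻¹ p z = Splits z p

    splits-total : ∀ {z} → Fact (u ∙ v) z → ∃[ p ] Splits z p
    splits-total {z₁ , z₂} Fz@(Sz₁ , Sz₂ , uv≡z₁z₂) with gcd-exists Su Sz₁
    ... | d , G with gcd-∣ˡ G
    ...   | u₁ , Su₁ , u≡du₁ with lcm-exists {v = d \\ z₁} Su₁
    ...     | b , Sb , L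
      with ∙-cancelˡ-∣ u₁ (lcm-least L (u∣u∙c Sv)
             (∣∙⇒\\∣ (subst (z₁ ∣_) (trans (cong (_∙ v) u≡du₁) (assoc d u₁ v)) (z₂ , Sz₂ , uv≡z₁z₂))))
    ...       | v₁ , Sv₁ , v≡bv₁ =
      ((d , u₁) , (b , v₁)) , Fz , (proj₁ G , Su₁ , u≡du₁) , (Sb , Sv₁ , v≡bv₁) , G , L

    splits-injective : ∀ {z z′ p} → Splits z p → Splits z′ p → z ≡ z′
    splits-injective {z₁ , z₂} {z₁′ , z₂′} {(d , u₁) , _}
      ((_ , _ , uv≡z₁z₂) , (_ , Su₁ , u≡du₁) , _ , G , L) ((_ , _ , uv≡z₁′z₂′) , _ , _ , G′ , L′) =
      cong₂ _,_ z₁≡z₁′ z₂≡z₂′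
      where
      d\\z⊥u₁ : ∀ {z} → IsGcd u z d → Coprime (d \\ z) u₁
      d\\z⊥u₁ {z} Gz = Coprime-sym (gcd-cofactors-coprime Gz u≡du₁ (sym (\\-leftDividesˡ d z)))
      z₁≡z₁′ : z₁ ≡ z₁′
      z₁≡z₁′ = ∙-cancelˡ (d ⁻¹) z₁ z₁′
        (coprime-complement-unique (∣⇒\\-S (gcd-∣ʳ G)) (∣⇒\\-S (gcd-∣ʳ G′)) Su₁
          (d\\z⊥u₁ G) (d\\z⊥u₁ G′) (IsLcm-sym L) (IsLcm-sym L′))
      z₂≡z₂′ : z₂ ≡ z₂′
      z₂≡z₂′ = ∙-cancelˡ z₁ z₂ z₂′
        (trans (sym uv≡z₁z₂) (trans uv≡z₁′z₂′ (cong (_∙ z₂′) (sym z₁≡z₁′))))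

    splits-functional : ∀ {z p p′} → Splits z p → Splits z p′ → p ≡ p′
    splits-functional {p = (d , u₁) , (b , v₁)} {(_ , u₁′) , (b′ , v₁′)}
      (_ , (_ , _ , u≡du₁) , (_ , _ , v≡bv₁) , G , L)
      (_ , (_ , _ , u≡d′u₁′) , (_ , _ , v≡b′v₁′) , G′ , L′)
      with gcd-unique G G′
    ... | refl with ∙-cancelˡ d u₁ u₁′ (trans (sym u≡du₁) u≡d′u₁′)
    ...   | refl with ∙-cancelˡ u₁ b b′ (lcm-unique L L′)
    ...     | refl with ∙-cancelˡ b v₁ v₁′ (trans (sym v≡bv₁) v≡b′v₁′)
    ...       | refl = refl

    splits-surjective : CastleFree u v → ∀ {d u₁ b v₁} → Fact u (d , u₁) → Fact v (b , v₁) →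
      ∃[ z ] Splits z ((d , u₁) , (b , v₁))
    splits-surjective uv-free {d} {u₁} {b} {v₁} Fu@(Sd , Su₁ , u≡du₁) Fv@(Sb , Sv₁ , v≡bv₁) =
      preimage (castleFree-∙⁻ Sd Su₁ Sb Sv₁ (subst₂ CastleFree u≡du₁ v≡bv₁ uv-free))
      where
      preimage : CastleFree u₁ b → ∃[ z ] Splits z ((d , u₁) , (b , v₁))
      preimage (w , _ , Sw , u₁⊥w , L) = (d ∙ w , k) , (S-∙ Sd Sw , Sk , uv≡dwk) , Fu , Fv , G
        , subst (λ t → IsLcm u₁ t (u₁ ∙ b)) (sym (\\-leftDividesʳ d w)) L
        where
        w∣u₁v : w ∣ (u₁ ∙ v)
        w∣u₁v = ∣-trans (lcm-∣ʳ L) (∙-monoʳ-∣ u₁ (subst (b ∣_) (sym v≡bv₁) (u∣u∙c Sv₁)))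
        k = proj₁ w∣u₁v
        Sk = proj₁ (proj₂ w∣u₁v)
        uv≡dwk : u ∙ v ≡ (d ∙ w) ∙ k
        uv≡dwk = begin
          u ∙ v          ≡⟨ cong (_∙ v) u≡du₁ ⟩
          (d ∙ u₁) ∙ v   ≡⟨ assoc d u₁ v ⟩
          d ∙ (u₁ ∙ v)   ≡⟨ cong (d ∙_) (proj₂ (proj₂ w∣u₁v)) ⟩
          d ∙ (w ∙ k)    ≡⟨ assoc d w k ⟨
          (d ∙ w) ∙ k    ∎
          where open ≡-Reasoning
        G : IsGcd u (d ∙ w) d
        G = subst (λ t → IsGcd t (d ∙ w) d) (sym u≡du₁) (Coprime⇒IsGcd-∙ Sd Su₁ Sw u₁⊥w)

    trivial-splitting⇒C₁ : ∀ {z} → Splits z ((ε , u) , (v , ε)) → C₁ (u , v)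
    trivial-splitting⇒C₁ {z₁ , _} (_ , _ , _ , G , L) = CastleFree⇒C₁ (ε \\ z₁ , Su , ∣⇒\\-S (gcd-∣ʳ G)
      , gcd-cofactors-coprime G (sym (identityˡ u)) (sym (\\-leftDividesˡ ε z₁)) , L)

    splits-injectiveOn : ∀ {zs} → InjectiveOn Splits zs
    splits-injectiveOn _ _ = splits-injective

    splits⁻¹-injectiveOn : ∀ {ys} → InjectiveOn Splits⁻¹ ys
    splits⁻¹-injectiveOn _ _ = splits-functional

    module _ {Lu Lv Luv : List (A × A)}
             (∈Lu : ∀ p → (p ∈ Lu) ⇔ Fact u p) (∈Lv : ∀ q → (q ∈ Lv) ⇔ Fact v q)
             (∈Luv : ∀ z → (z ∈ Luv) ⇔ Fact (u ∙ v) z) where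

      splits-totalOn : TotalOn Splits Luv (cartesianProduct Lu Lv)
      splits-totalOn z∈ = addMembership (splits-total (to (∈Luv _) z∈))
        where
        addMembership : ∀ {z} → ∃[ p ] Splits z p → ∃[ p ] (p ∈ cartesianProduct Lu Lv × Splits z p)
        addMembership ((p , q) , s@(_ , Fp , Fq , _)) =
          (p , q) , ∈-cartesianProduct⁺ (from (∈Lu p) Fp) (from (∈Lv q) Fq) , s

      splits⁻¹-totalOn : CastleFree u v → TotalOn Splits⁻¹ (cartesianProduct Lu Lv) Luv
      splits⁻¹-totalOn uv-free {p , q} pq∈ =
        addMembership (splits-surjective uv-free (to (∈Lu p) p∈) (to (∈Lv q) q∈))
        where
        p∈ = proj₁ (∈-cartesianProduct⁻ Lu Lv pq∈)
        q∈ = proj₂ (∈-cartesianProduct⁻ Lu Lv pq∈)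
        addMembership : ∀ {p} → ∃[ z ] Splits z p → ∃[ z ] (z ∈ Luv × Splits z p)
        addMembership (z , s@(Fz , _)) = z , from (∈Luv z) Fz , s

      trivial-splitting∈ : ((ε , u) , (v , ε)) ∈ cartesianProduct Lu Lv
      trivial-splitting∈ = ∈-cartesianProduct⁺ (from (∈Lu _) (S-ε , Su , sym (identityˡ u)))
                                                (from (∈Lv _) (Sv , S-ε , sym (identityʳ v)))

    τ-∙-≤ : ∀ {a b c} → TauIs u a → TauIs v b → TauIs (u ∙ v) c → c ≤ a * b
    τ-∙-≤ (Lu , _ , ∈Lu , refl) (Lv , _ , ∈Lv , refl) (Luv , Luv! , ∈Luv , refl) = begin
      length Luv                       ≤⟨ injectiveOn⇒length≤ Splits Luv! (splits-totalOn ∈Lu ∈Lv ∈Luv)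
                                                                          splits-injectiveOn ⟩
      length (cartesianProduct Lu Lv)  ≡⟨ length-cartesianProduct Lu Lv ⟩
      length Lu * length Lv            ∎
      where open ≤-Reasoning

    castleFree⇒τ-∙-≥ : ∀ {a b c} → CastleFree u v →
      TauIs u a → TauIs v b → TauIs (u ∙ v) c → a * b ≤ c
    castleFree⇒τ-∙-≥ uv-free (Lu , Lu! , ∈Lu , refl) (Lv , Lv! , ∈Lv , refl) (Luv , _ , ∈Luv , refl) = begin
      length Lu * length Lv            ≡⟨ length-cartesianProduct Lu Lv ⟨
      length (cartesianProduct Lu Lv)  ≤⟨ injectiveOn⇒length≤ Splits⁻¹ (cartesianProduct⁺ Lu! Lv!)
                                            (splits⁻¹-totalOn ∈Lu ∈Lv ∈Luv uv-free) splits⁻¹-injectiveOn ⟩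
      length Luv                       ∎
      where open ≤-Reasoning

    τ-∙-≡⇒C₁ : ∀ {a b c} → TauIs u a → TauIs v b → TauIs (u ∙ v) c → c ≡ a * b → C₁ (u , v)
    τ-∙-≡⇒C₁ (Lu , _ , ∈Lu , refl) (Lv , _ , ∈Lv , refl) (Luv , Luv! , ∈Luv , refl) τ≡ =
      trivial-splitting⇒C₁ (proj₂ (proj₂ preimage))
      where
      preimage = injectiveOn∧length≥⇒surjective Splits (≡-dec (≡-dec _≟_ _≟_) (≡-dec _≟_ _≟_)) Luv!
        (splits-totalOn ∈Lu ∈Lv ∈Luv) splits-injectiveOn
        (≤-reflexive (trans (length-cartesianProduct Lu Lv) (sym τ≡))) (trivial-splitting∈ ∈Lu ∈Lv ∈Luv)

    C₁⇒τ-∙-≡ : ∀ {a b c} → TauIs u a → TauIs v b → TauIs (u ∙ v) c → C₁ (u , v) → c ≡ a * b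
    C₁⇒τ-∙-≡ τu τv τuv uv∈C₁ =
      ≤-antisym (τ-∙-≤ τu τv τuv) (castleFree⇒τ-∙-≥ (C₁⇒CastleFree uv∈C₁) τu τv τuv)

open Defs using (IsHomogeneous; TauIs; C₁)

mainTheorem5 : {A : Set} (_∙_ : A → A → A) (ε : A) (_⁻¹ : A → A) (S : A → Set)
    → IsHomogeneous _∙_ ε _⁻¹ S
    → ∀ u v → S u → S v
    → ∀ a b c → TauIs _∙_ ε _⁻¹ S u a → TauIs _∙_ ε _⁻¹ S v b
    → TauIs _∙_ ε _⁻¹ S (u ∙ v) c
    → (c ≤ a * b) × ((c ≡ a * b) ⇔ C₁ _∙_ ε _⁻¹ S (u , v))
mainTheorem5 _∙_ ε _⁻¹ S homogeneous u v Su Sv _ _ _ τu τv τuv =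
  τ-∙-≤ τu τv τuv , mk⇔ (τ-∙-≡⇒C₁ τu τv τuv) (C₁⇒τ-∙-≡ τu τv τuv)
  where
  open Homogeneous _∙_ ε _⁻¹ S homogeneous
  open Correspondence Su Sv
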